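{- Let $p$ be an odd prime such that the value $1\in\mathbb{F}_p$ is hyperbolic, i.e. $5=3^2-4$ is a nonzero square modulo $p$. Then $(1,1,1)\notin\mathcal{C}(p)$.
   Context: For a prime $p$, $\mathcal{X}^*(p)$ is the set of nonzero solutions in $\mathbb{F}_p^3$ of $x_1^2+x_2^2+x_3^2=3x_1x_2x_3$. Rotations: $\mathrm{rot}_1(x_1,x_2,x_3)=(x_1,x_3,3x_1x_3-x_2)$, $\mathrm{rot}_2(x_1,x_2,x_3)=(x_3,x_2,3x_2x_3-x_1)$, $\mathrm{rot}_3(x_1,x_2,x_3)=(x_2,3x_2x_3-x_1,x_3)$; $\mathrm{ord}_{p,i}(\mathbf{x})=\min\{n\in\mathbb{Z}_{>0}:\mathrm{rot}_i^n(\mathbf{x})=\mathbf{x}\}$ (equivalently the order of $\begin{pmatrix}0&1\\-1&3x_i\end{pmatrix}$ in $\mathrm{GL}_2(\mathbb{F}_p)$). A point $\mathbf{x}\in\mathcal{X}^*(p)$ is maximal if $\mathrm{ord}_{p,i}(\mathbf{x})\in\{p-1,p+1,2p\}$ for some $i$; the cage $\mathcal{C}(p)$ is the set of all maximal points of $\mathcal{X}^*(p)$. -}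

module Defs where

open import Data.Nat using (ℕ; zero; suc; _+_; _*_; _∸_; _<_)
open import Data.Nat.DivMod using (_%_)
open import Data.Product using (_×_; _,_; Σ; ∃; ∃-syntax)
open import Data.Sum using (_⊎_)
open import Data.Fin using (Fin; zero; suc)
open import Relation.Binary.PropositionalEquality using (_≡_; _≢_)
open import Relation.Nullary using (¬_)

-- Reduction modulo p (elements of F_p are represented by naturals < p).
_mod_ : ℕ → ℕ → ℕ
a mod zero    = a
a mod (suc k) = a % suc k

Point : Set
Point = ℕ × ℕ × ℕ

InX* : ℕ → Point → Set
InX* p (x₁ , x₂ , x₃) =
  (x₁ < p × x₂ < p × x₃ < p) ×
  ¬ (x₁ ≡ 0 × x₂ ≡ 0 × x₃ ≡ 0) ×
  ((x₁ * x₁ + x₂ * x₂ + x₃ * x₃) mod p ≡ (3 * x₁ * x₂ * x₃) mod p)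

-- The Markoff rotations over F_p (subtraction of a reduced y realised as + (p ∸ y)).
rot : ℕ → Fin 3 → Point → Point
rot p zero             (x₁ , x₂ , x₃) = x₁ , x₃ , (3 * x₁ * x₃ + (p ∸ x₂)) mod p
rot p (suc zero)       (x₁ , x₂ , x₃) = x₃ , x₂ , (3 * x₂ * x₃ + (p ∸ x₁)) mod p
rot p (suc (suc zero)) (x₁ , x₂ , x₃) = x₂ , (3 * x₂ * x₃ + (p ∸ x₁)) mod p , x₃

rotIter : ℕ → Fin 3 → ℕ → Point → Point
rotIter p i zero    x = x
rotIter p i (suc n) x = rot p i (rotIter p i n x)

IsOrd : ℕ → Fin 3 → Point → ℕ → Set
IsOrd p i x n =
  0 < n × rotIter p i n x ≡ x × (∀ m → 0 < m → m < n → rotIter p i m x ≢ x)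

InCage : ℕ → Point → Set
InCage p x =
  InX* p x ×
  Σ (Fin 3) λ i → Σ ℕ λ n → IsOrd p i x n ×
    (n ≡ p ∸ 1 ⊎ n ≡ p + 1 ⊎ n ≡ 2 * p)

OneHyperbolic : ℕ → Set
OneHyperbolic p = (5 mod p ≢ 0) × ∃[ y ] ((y * y) mod p ≡ 5 mod p)

{-# OPTIONS --safe #-}

-- The rotation rot_i fixes the i-th coordinate of (1, 1, 1) and moves the other two
-- by the linear recurrence (a, b) ↦ (b, 3b − a), whose characteristic polynomial
-- t² − 3t + 1 has the roots α = φ², β = ψ², where φ, ψ = (1 ± √5)/2 lie in 𝔽_p
-- because 5 is a square.  Writing p = 2m + 1, Fermat's little theorem gives
-- α^m = φ^(p−1) = 1 and β^m = 1, and as α − β = √5 ≠ 0 the vector (1, 1) splits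
-- along the two eigenlines.  Hence rot_i^m fixes (1, 1, 1), so its order is at
-- most (p − 1)/2, which is smaller than each of p − 1, p + 1 and 2p.

module Submission where

open import Defs
open import Data.Nat using (ℕ)
open import Data.Nat.Primality using (Prime)
open import Data.Product using (_,_)
open import Relation.Binary.PropositionalEquality using (_≢_)
open import Relation.Nullary using (¬_)

open import Algebra.Bundles using (CommutativeSemiring; CommutativeRing)
open import Algebra.Structures using (IsCommutativeRing)
open import Data.Empty using (⊥-elim)
open import Data.Fin.Base using (Fin; zero; suc; fromℕ)
open import Data.Fin.Properties using (inject₁ℕ<; toℕ-fromℕ)
open import Data.Nat.Base as ℕ using (zero; suc; _<_; _≤_; s≤s; z≤n; _!; NonZero)
open import Data.Nat.Combinatorics using (_C_; nCn≡1; k![n∸k]!∣n!)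
open import Data.Nat.Combinatorics.Specification using (nCk≡n!/k![n-k]!)
open import Data.Nat.Divisibility using (_∣_; _∤_; divides; ∣1⇒≡1; ∣⇒≤; m∣m*n)
open import Data.Nat.DivMod using (m/n*n≡m; m%n<n)
open import Data.Nat.Primality using (euclidsLemma; prime⇒nonTrivial; prime⇒irreducible)
import Data.Nat.Properties as ℕ
open import Data.Product using (_×_; ∃-syntax; proj₁; proj₂)
open import Data.Sum using (_⊎_; inj₁; inj₂; [_,_]′)
open import Data.Vec.Functional using (init; tail; replicate)
open import Level using (0ℓ)
open import Relation.Binary.PropositionalEquality as ≡ using (_≡_; refl; cong; cong₂; subst)
open import Relation.Binary.Structures using (IsEquivalence)

p∤n! : ∀ {p n} → Prime p → n < p → p ∤ n !
p∤n! {n = zero}  p-prime _   p∣1  = ℕ.nonTrivial⇒≢1 {{prime⇒nonTrivial p-prime}} (∣1⇒≡1 p∣1)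
p∤n! {n = suc n} p-prime n<p p∣n! with euclidsLemma (suc n) (n !) p-prime p∣n!
... | inj₁ p∣1+n = ℕ.<⇒≱ n<p (∣⇒≤ p∣1+n)
... | inj₂ p∣n!′ = p∤n! p-prime (ℕ.<-trans (ℕ.n<1+n n) n<p) p∣n!′

nCk*k![n∸k]!≡n! : ∀ {n k} → k ≤ n → (n C k) ℕ.* (k ! ℕ.* (n ℕ.∸ k) !) ≡ n !
nCk*k![n∸k]!≡n! {n} {k} k≤n =
  ≡.trans (cong (ℕ._* (k ! ℕ.* (n ℕ.∸ k) !)) (nCk≡n!/k![n-k]! k≤n))
          (m/n*n≡m {{ℕ._!*_!≢0 k (n ℕ.∸ k)}} (k![n∸k]!∣n! k≤n))

p∣pCk : ∀ {p k} → Prime p → 0 < k → k < p → p ∣ p C k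
p∣pCk {suc q} {k} p-prime 0<k k<p
  with euclidsLemma (suc q C k) (k ! ℕ.* (suc q ℕ.∸ k) !) p-prime
         (subst (suc q ∣_) (≡.sym (nCk*k![n∸k]!≡n! (ℕ.<⇒≤ k<p))) (m∣m*n (q !)))
... | inj₁ p∣C = p∣C
... | inj₂ p∣k![p∸k]! with euclidsLemma (k !) ((suc q ℕ.∸ k) !) p-prime p∣k![p∸k]!
...   | inj₁ p∣k!     = ⊥-elim (p∤n! p-prime k<p p∣k!)
...   | inj₂ p∣[p∸k]! = ⊥-elim (p∤n! p-prime (ℕ.∸-monoʳ-< 0<k (ℕ.<⇒≤ k<p)) p∣[p∸k]!)

even-or-odd : ∀ n → ∃[ m ] (n ≡ m ℕ.+ m ⊎ n ≡ suc (m ℕ.+ m))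
even-or-odd zero = 0 , inj₁ refl
even-or-odd (suc n) with even-or-odd n
... | m , inj₁ n≡m+m   = m , inj₂ (cong suc n≡m+m)
... | m , inj₂ n≡1+m+m = suc m , inj₁ (cong suc (≡.trans n≡1+m+m (≡.sym (ℕ.+-suc m m))))

2∣m+m : ∀ m → 2 ∣ m ℕ.+ m
2∣m+m m = divides m (≡.trans (cong (m ℕ.+_) (≡.sym (ℕ.+-identityʳ m))) (ℕ.*-comm 2 m))

prime≢2⇒odd : ∀ {p} → Prime p → p ≢ 2 → ∃[ m ] (0 < m × p ≡ suc (m ℕ.+ m))
prime≢2⇒odd {p} p-prime p≢2 with even-or-odd p
... | m , inj₁ refl with prime⇒irreducible p-prime (2∣m+m m)
...   | inj₂ 2≡p = ⊥-elim (p≢2 (≡.sym 2≡p))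
prime≢2⇒odd p-prime p≢2 | zero  , inj₂ refl = ⊥-elim (ℕ.nonTrivial⇒≢1 {{prime⇒nonTrivial p-prime}} refl)
prime≢2⇒odd p-prime p≢2 | suc m , inj₂ refl = suc m , s≤s z≤n , refl

module Frobenius {c ℓ} (S : CommutativeSemiring c ℓ) {q : ℕ} (p-prime : Prime (suc q)) where
  open CommutativeSemiring S hiding (zero)
  open import Algebra.Properties.Semiring.Exp semiring using (_^_)
  open import Algebra.Properties.Monoid.Mult +-monoid as Mult using (×-congˡ; ×-assocˡ)
  open import Algebra.Properties.Monoid.Sum +-monoid
    using (sum; sum-init-last; sum-cong-≋; sum-replicate-zero)
  open import Algebra.Properties.CommutativeSemiring.Binomial S using (theorem; binomialTerm)
  open import Relation.Binary.Reasoning.Setoid setoid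

  p : ℕ
  p = suc q

  binomialTerm-first : ∀ x y n → binomialTerm x y n zero ≈ y ^ n
  binomialTerm-first x y n = trans (+-identityʳ _) (*-identityˡ _)

  binomialTerm-last : ∀ x y n → binomialTerm x y n (fromℕ n) ≈ x ^ n
  binomialTerm-last x y n rewrite toℕ-fromℕ n | nCn≡1 n | ℕ.n∸n≡0 n =
    trans (+-identityʳ _) (*-identityʳ _)

  module _ (p×≈0 : ∀ x → p Mult.× x ≈ 0#) where

    p∣k⇒k×≈0 : ∀ {k} x → p ∣ k → k Mult.× x ≈ 0#
    p∣k⇒k×≈0 {k} x (divides c k≡c*p) = begin
      k Mult.× x             ≈⟨ ×-congˡ (≡.trans k≡c*p (ℕ.*-comm c p)) ⟩
      (p ℕ.* c) Mult.× x     ≈⟨ ×-assocˡ x p c ⟨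
      p Mult.× (c Mult.× x)  ≈⟨ p×≈0 (c Mult.× x) ⟩
      0#                     ∎

    [x+y]^p≈x^p+y^p : ∀ x y → (x + y) ^ p ≈ x ^ p + y ^ p
    [x+y]^p≈x^p+y^p x y = begin
      (x + y) ^ p                                   ≈⟨ theorem p x y ⟩
      t zero + sum (tail t)                         ≈⟨ +-congˡ (sum-init-last (tail t)) ⟩
      t zero + (sum (init (tail t)) + t (fromℕ p))  ≈⟨ +-congˡ (+-congʳ binomialTerms≈0) ⟩
      t zero + (0# + t (fromℕ p))                   ≈⟨ +-congˡ (+-identityˡ (t (fromℕ p))) ⟩
      t zero + t (fromℕ p)                          ≈⟨ +-comm (t zero) (t (fromℕ p)) ⟩
      t (fromℕ p) + t zero                          ≈⟨ +-cong (binomialTerm-last x y p) (binomialTerm-first x y p) ⟩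
      x ^ p + y ^ p                                 ∎
      where
      t : Fin (suc p) → Carrier
      t = binomialTerm x y p
      binomialTerms≈0 : sum (init (tail t)) ≈ 0#
      binomialTerms≈0 = begin
        sum (init (tail t))  ≈⟨ sum-cong-≋ (λ i → p∣k⇒k×≈0 _ (p∣pCk p-prime (s≤s z≤n) (s≤s (inject₁ℕ< i)))) ⟩
        sum (replicate q 0#) ≈⟨ sum-replicate-zero q ⟩
        0#                   ∎

-- Opened only here, so that ℤ's operators do not clash with those of S in Frobenius.
open import Data.Integer.Base using (ℤ; +_; ∣_∣; _+_; _*_; -_; _-_; 0ℤ; 1ℤ; _%ℕ_; _/ℕ_)
open import Data.Integer.DivMod using (a≡a%ℕn+[a/ℕn]*n)
import Data.Integer.Divisibility.Signed as ℤ
import Data.Integer.Properties as ℤ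
open import Data.Integer.Tactic.RingSolver using (solve-∀)

module IntegersModulo (n : ℕ) where

  infix 4 _≈_
  record _≈_ (a b : ℤ) : Set where
    constructor n∣difference
    field n∣a-b : + n ℤ.∣ a - b

  ≈-by : ∀ {a b c} → c ≡ a - b → + n ℤ.∣ c → a ≈ b
  ≈-by c≡a-b n∣c = n∣difference (subst (+ n ℤ.∣_) c≡a-b n∣c)

  ≈-reflexive : ∀ {a b} → a ≡ b → a ≈ b
  ≈-reflexive {a} refl = ≈-by (≡.sym (ℤ.+-inverseʳ a)) (ℤ.divides 0ℤ refl)

  ≈-sym : ∀ {a b} → a ≈ b → b ≈ a
  ≈-sym {a} {b} (n∣difference n∣a-b) = ≈-by (lemma a b) (ℤ.∣m⇒∣-m n∣a-b)
    where
    lemma : ∀ a b → - (a - b) ≡ b - a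
    lemma = solve-∀

  ≈-trans : ∀ {a b c} → a ≈ b → b ≈ c → a ≈ c
  ≈-trans {a} {b} {c} (n∣difference n∣a-b) (n∣difference n∣b-c) =
    ≈-by (lemma a b c) (ℤ.∣m∣n⇒∣m+n n∣a-b n∣b-c)
    where
    lemma : ∀ a b c → (a - b) + (b - c) ≡ a - c
    lemma = solve-∀

  +-cong : ∀ {a b c d} → a ≈ b → c ≈ d → a + c ≈ b + d
  +-cong {a} {b} {c} {d} (n∣difference n∣a-b) (n∣difference n∣c-d) =
    ≈-by (lemma a b c d) (ℤ.∣m∣n⇒∣m+n n∣a-b n∣c-d)
    where
    lemma : ∀ a b c d → (a - b) + (c - d) ≡ (a + c) - (b + d)
    lemma = solve-∀

  *-cong : ∀ {a b c d} → a ≈ b → c ≈ d → a * c ≈ b * d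
  *-cong {a} {b} {c} {d} (n∣difference n∣a-b) (n∣difference n∣c-d) =
    ≈-by (lemma a b c d) (ℤ.∣m∣n⇒∣m+n (ℤ.∣m⇒∣m*n c n∣a-b) (ℤ.∣n⇒∣m*n b n∣c-d))
    where
    lemma : ∀ a b c d → (a - b) * c + b * (c - d) ≡ a * c - b * d
    lemma = solve-∀

  -‿cong : ∀ {a b} → a ≈ b → - a ≈ - b
  -‿cong {a} {b} (n∣difference n∣a-b) = ≈-by (lemma a b) (ℤ.∣m⇒∣-m n∣a-b)
    where
    lemma : ∀ a b → - (a - b) ≡ - a - - b
    lemma = solve-∀

  +-congˡ : ∀ a {b c} → b ≈ c → a + b ≈ a + c
  +-congˡ a = +-cong (≈-reflexive {a} refl)

  +-congʳ : ∀ c {a b} → a ≈ b → a + c ≈ b + c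
  +-congʳ c a≈b = +-cong a≈b (≈-reflexive {c} refl)

  *-congˡ : ∀ a {b c} → b ≈ c → a * b ≈ a * c
  *-congˡ a = *-cong (≈-reflexive {a} refl)

  *-congʳ : ∀ c {a b} → a ≈ b → a * c ≈ b * c
  *-congʳ c a≈b = *-cong a≈b (≈-reflexive {c} refl)

  ≈-isEquivalence : IsEquivalence _≈_
  ≈-isEquivalence = record { refl = ≈-reflexive refl ; sym = ≈-sym ; trans = ≈-trans }

  +-*-isCommutativeRing : IsCommutativeRing _≈_ _+_ _*_ -_ 0ℤ 1ℤ
  +-*-isCommutativeRing = record
    { isRing = record
      { +-isAbelianGroup = record
        { isGroup = record
          { isMonoid = record
            { isSemigroup = record
              { isMagma = record { isEquivalence = ≈-isEquivalence ; ∙-cong = +-cong }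
              ; assoc = λ a b c → ≈-reflexive (ℤ.+-assoc a b c)
              }
            ; identity = (λ a → ≈-reflexive (ℤ.+-identityˡ a)) , (λ a → ≈-reflexive (ℤ.+-identityʳ a))
            }
          ; inverse = (λ a → ≈-reflexive (ℤ.+-inverseˡ a)) , (λ a → ≈-reflexive (ℤ.+-inverseʳ a))
          ; ⁻¹-cong = -‿cong
          }
        ; comm = λ a b → ≈-reflexive (ℤ.+-comm a b)
        }
      ; *-cong = *-cong
      ; *-assoc = λ a b c → ≈-reflexive (ℤ.*-assoc a b c)
      ; *-identity = (λ a → ≈-reflexive (ℤ.*-identityˡ a)) , (λ a → ≈-reflexive (ℤ.*-identityʳ a))
      ; distrib = (λ a b c → ≈-reflexive (ℤ.*-distribˡ-+ a b c)) , (λ a b c → ≈-reflexive (ℤ.*-distribʳ-+ a b c))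
      }
    ; *-comm = λ a b → ≈-reflexive (ℤ.*-comm a b)
    }

  ℤ/nℤ : CommutativeRing 0ℓ 0ℓ
  ℤ/nℤ = record { isCommutativeRing = +-*-isCommutativeRing }

  open CommutativeRing ℤ/nℤ public
    using (setoid; commutativeSemiring; +-monoid)
  open import Algebra.Properties.CommutativeSemiring.Exp commutativeSemiring public
    using (_^_; ^-congˡ; ^-homo-*; ^-distrib-*)
  import Algebra.Properties.Monoid.Mult +-monoid as Mult

  ∣⇒≈0 : ∀ {a} → + n ℤ.∣ a → a ≈ 0ℤ
  ∣⇒≈0 {a} = ≈-by (≡.sym (ℤ.+-identityʳ a))

  ≈0⇒∣ : ∀ {a} → a ≈ 0ℤ → + n ℤ.∣ a
  ≈0⇒∣ {a} (n∣difference n∣a-0) = subst (+ n ℤ.∣_) (ℤ.+-identityʳ a) n∣a-0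

  k×x≈k*x : ∀ k x → k Mult.× x ≈ + k * x
  k×x≈k*x zero    x = ≈-reflexive refl
  k×x≈k*x (suc k) x = ≈-trans (+-congˡ x (k×x≈k*x k x)) (≈-reflexive (lemma (+ k) x))
    where
    lemma : ∀ k x → x + k * x ≡ (1ℤ + k) * x
    lemma = solve-∀

  n×x≈0 : ∀ x → n Mult.× x ≈ 0ℤ
  n×x≈0 x = ≈-trans (k×x≈k*x n x) (∣⇒≈0 (ℤ.∣m⇒∣m*n x ℤ.∣-refl))

  ≈-%ℕ : .{{_ : NonZero n}} → ∀ a → a ≈ + (a %ℕ n)
  ≈-%ℕ a = ≈-by [a/n]*n≡a-[a%n] (ℤ.divides (a /ℕ n) refl)
    where
    lemma : ∀ r d n → d * n ≡ (r + d * n) - r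
    lemma = solve-∀
    [a/n]*n≡a-[a%n] : (a /ℕ n) * + n ≡ a - + (a %ℕ n)
    [a/n]*n≡a-[a%n] = ≡.trans (lemma (+ (a %ℕ n)) (a /ℕ n) (+ n))
                              (cong (_- + (a %ℕ n)) (≡.sym (a≡a%ℕn+[a/ℕn]*n a n)))

  n∸a≈-a : ∀ {a} → a ≤ n → + (n ℕ.∸ a) ≈ - + a
  n∸a≈-a {a} a≤n = ≈-by n≡[n∸a]-[-a] ℤ.∣-refl
    where
    open ≡.≡-Reasoning
    n≡[n∸a]-[-a] : + n ≡ + (n ℕ.∸ a) - - + a
    n≡[n∸a]-[-a] = begin
      + n                     ≡⟨ cong +_ (ℕ.m∸n+n≡m a≤n) ⟨
      + (n ℕ.∸ a ℕ.+ a)       ≡⟨ ℤ.pos-+ (n ℕ.∸ a) a ⟩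
      + (n ℕ.∸ a) + + a       ≡⟨ cong (_+_ (+ (n ℕ.∸ a))) (ℤ.neg-involutive (+ a)) ⟨
      + (n ℕ.∸ a) - - + a     ∎

  ≈⇒≡ : ∀ {a b} → a < n → b < n → + a ≈ + b → a ≡ b
  ≈⇒≡ {zero}  {zero}  _     _     _ = refl
  ≈⇒≡ {zero}  {suc b} _     1+b<n (n∣difference n∣-[1+b]) =
    ⊥-elim (ℕ.<⇒≱ 1+b<n (∣⇒≤ (ℤ.∣⇒∣ᵤ n∣-[1+b])))
  ≈⇒≡ {suc a} {zero}  1+a<n 0<n   1+a≈0 = ≡.sym (≈⇒≡ 0<n 1+a<n (≈-sym 1+a≈0))
  ≈⇒≡ {suc a} {suc b} 1+a<n 1+b<n (n∣difference n∣[1+a]-[1+b]) =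
    cong suc (≈⇒≡ (ℕ.<⇒≤ 1+a<n) (ℕ.<⇒≤ 1+b<n) (≈-by (lemma (+ a) (+ b)) n∣[1+a]-[1+b]))
    where
    lemma : ∀ a b → (1ℤ + a) - (1ℤ + b) ≡ a - b
    lemma = solve-∀

  -- For roots α, β of t² − σt + 1, b − βa is an eigen-coordinate of the step
  -- (a, b) ↦ (b, σb − a) with eigenvalue α.
  module Orbit (σ : ℤ) (a b : ℕ → ℤ)
               (a-suc : ∀ k → a (suc k) ≈ b k)
               (b-suc : ∀ k → b (suc k) ≈ σ * b k - a k) where
    open import Relation.Binary.Reasoning.Setoid setoid

    module _ {α β : ℤ} (α+β≈σ : α + β ≈ σ) (αβ≈1 : α * β ≈ 1ℤ) where

      eigen-step : ∀ k → b (suc k) - β * a (suc k) ≈ α * (b k - β * a k)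
      eigen-step k = begin
        b (suc k) - β * a (suc k)        ≈⟨ +-cong (b-suc k) (-‿cong (*-congˡ β (a-suc k))) ⟩
        (σ * b k - a k) - β * b k        ≈⟨ +-congʳ (- (β * b k)) (+-congʳ (- a k) (*-congʳ (b k) (≈-sym α+β≈σ))) ⟩
        ((α + β) * b k - a k) - β * b k  ≡⟨ lemma₁ α β (a k) (b k) ⟩
        α * b k - 1ℤ * a k               ≈⟨ +-congˡ (α * b k) (-‿cong (*-congʳ (a k) (≈-sym αβ≈1))) ⟩
        α * b k - (α * β) * a k          ≡⟨ lemma₂ α β (a k) (b k) ⟩
        α * (b k - β * a k)              ∎
        where
        lemma₁ : ∀ α β a b → ((α + β) * b - a) - β * b ≡ α * b - 1ℤ * a
        lemma₁ = solve-∀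
        lemma₂ : ∀ α β a b → α * b - (α * β) * a ≡ α * (b - β * a)
        lemma₂ = solve-∀

      eigen-power : ∀ k → b k - β * a k ≈ α ^ k * (b 0 - β * a 0)
      eigen-power zero    = ≈-reflexive (≡.sym (ℤ.*-identityˡ _))
      eigen-power (suc k) = begin
        b (suc k) - β * a (suc k)      ≈⟨ eigen-step k ⟩
        α * (b k - β * a k)            ≈⟨ *-congˡ α (eigen-power k) ⟩
        α * (α ^ k * (b 0 - β * a 0))  ≡⟨ ℤ.*-assoc α (α ^ k) _ ⟨
        α ^ suc k * (b 0 - β * a 0)    ∎

    eigen-fixed : ∀ {α β m} → α + β ≈ σ → α * β ≈ 1ℤ → α ^ m ≈ 1ℤ →
                  b m - β * a m ≈ b 0 - β * a 0
    eigen-fixed {α} {β} {m} α+β≈σ αβ≈1 α^m≈1 = begin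
      b m - β * a m                ≈⟨ eigen-power α+β≈σ αβ≈1 m ⟩
      α ^ m * (b 0 - β * a 0)      ≈⟨ *-congʳ (b 0 - β * a 0) α^m≈1 ⟩
      1ℤ * (b 0 - β * a 0)         ≡⟨ ℤ.*-identityˡ _ ⟩
      b 0 - β * a 0                ∎

    periodic : ∀ {α β m} → α + β ≈ σ → α * β ≈ 1ℤ → α ^ m ≈ 1ℤ → β ^ m ≈ 1ℤ →
               (∀ {x y} → (α - β) * x ≈ (α - β) * y → x ≈ y) →
               a m ≈ a 0 × b m ≈ b 0
    periodic {α} {β} {m} α+β≈σ αβ≈1 α^m≈1 β^m≈1 cancel = cancel a-fixed , cancel b-fixed
      where
      e f : ℕ → ℤ
      e k = b k - β * a k
      f k = b k - α * a k
      e-fixed : e m ≈ e 0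
      e-fixed = eigen-fixed α+β≈σ αβ≈1 α^m≈1
      f-fixed : f m ≈ f 0
      f-fixed = eigen-fixed (≈-trans (≈-reflexive (ℤ.+-comm β α)) α+β≈σ)
                            (≈-trans (≈-reflexive (ℤ.*-comm β α)) αβ≈1) β^m≈1
      [α-β]a≡e-f : ∀ k → (α - β) * a k ≡ e k - f k
      [α-β]a≡e-f k = lemma α β (a k) (b k)
        where
        lemma : ∀ α β a b → (α - β) * a ≡ (b - β * a) - (b - α * a)
        lemma = solve-∀
      [α-β]b≡αe-βf : ∀ k → (α - β) * b k ≡ α * e k - β * f k
      [α-β]b≡αe-βf k = lemma α β (a k) (b k)
        where
        lemma : ∀ α β a b → (α - β) * b ≡ α * (b - β * a) - β * (b - α * a)
        lemma = solve-∀
      a-fixed : (α - β) * a m ≈ (α - β) * a 0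
      a-fixed = begin
        (α - β) * a m      ≡⟨ [α-β]a≡e-f m ⟩
        e m - f m          ≈⟨ +-cong e-fixed (-‿cong f-fixed) ⟩
        e 0 - f 0          ≡⟨ [α-β]a≡e-f 0 ⟨
        (α - β) * a 0      ∎
      b-fixed : (α - β) * b m ≈ (α - β) * b 0
      b-fixed = begin
        (α - β) * b m      ≡⟨ [α-β]b≡αe-βf m ⟩
        α * e m - β * f m  ≈⟨ +-cong (*-congˡ α e-fixed) (-‿cong (*-congˡ β f-fixed)) ⟩
        α * e 0 - β * f 0  ≡⟨ [α-β]b≡αe-βf 0 ⟨
        (α - β) * b 0      ∎

  -- h is an inverse of 2, so φ, ψ are the roots (1 ± Y)/2 of t² − t − 1 and
  -- their squares α, β are the roots of t² − 3t + 1.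
  module GoldenRatio (Y h : ℤ) (Y²≈5 : Y * Y ≈ + 5) (2h≈1 : + 2 * h ≈ 1ℤ) where
    open import Relation.Binary.Reasoning.Setoid setoid

    φ ψ α β : ℤ
    φ = h * (1ℤ + Y)
    ψ = h * (1ℤ - Y)
    α = φ * φ
    β = ψ * ψ

    φ+ψ≈1 : φ + ψ ≈ 1ℤ
    φ+ψ≈1 = ≈-trans (≈-reflexive (lemma h Y)) 2h≈1
      where
      lemma : ∀ h Y → h * (1ℤ + Y) + h * (1ℤ - Y) ≡ + 2 * h
      lemma = solve-∀

    φψ≈-1 : φ * ψ ≈ - 1ℤ
    φψ≈-1 = begin
      φ * ψ                       ≡⟨ lemma₁ h Y ⟩
      h * h * (1ℤ - Y * Y)        ≈⟨ *-congˡ (h * h) (+-congˡ 1ℤ (-‿cong Y²≈5)) ⟩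
      h * h * (1ℤ - + 5)          ≡⟨ lemma₂ h ⟩
      - ((+ 2 * h) * (+ 2 * h))   ≈⟨ -‿cong (*-cong 2h≈1 2h≈1) ⟩
      - 1ℤ                        ∎
      where
      lemma₁ : ∀ h Y → h * (1ℤ + Y) * (h * (1ℤ - Y)) ≡ h * h * (1ℤ - Y * Y)
      lemma₁ = solve-∀
      lemma₂ : ∀ h → h * h * (1ℤ - + 5) ≡ - ((+ 2 * h) * (+ 2 * h))
      lemma₂ = solve-∀

    α+β≈3 : α + β ≈ + 3
    α+β≈3 = begin
      α + β                            ≡⟨ lemma₁ φ ψ ⟩
      (φ + ψ) * (φ + ψ) - + 2 * (φ * ψ) ≈⟨ +-cong (*-cong φ+ψ≈1 φ+ψ≈1) (-‿cong (*-congˡ (+ 2) φψ≈-1)) ⟩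
      1ℤ * 1ℤ - + 2 * - 1ℤ             ≡⟨⟩
      + 3                              ∎
      where
      lemma₁ : ∀ φ ψ → φ * φ + ψ * ψ ≡ (φ + ψ) * (φ + ψ) - + 2 * (φ * ψ)
      lemma₁ = solve-∀

    αβ≈1 : α * β ≈ 1ℤ
    αβ≈1 = begin
      α * β                ≡⟨ lemma φ ψ ⟩
      (φ * ψ) * (φ * ψ)    ≈⟨ *-cong φψ≈-1 φψ≈-1 ⟩
      - 1ℤ * - 1ℤ          ≡⟨⟩
      1ℤ                   ∎
      where
      lemma : ∀ φ ψ → φ * φ * (ψ * ψ) ≡ (φ * ψ) * (φ * ψ)
      lemma = solve-∀

    α-β≈Y : α - β ≈ Y
    α-β≈Y = begin
      α - β                         ≡⟨ lemma₁ h Y ⟩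
      (φ + ψ) * ((+ 2 * h) * Y)     ≈⟨ *-cong φ+ψ≈1 (*-congʳ Y 2h≈1) ⟩
      1ℤ * (1ℤ * Y)                 ≡⟨ lemma₂ Y ⟩
      Y                             ∎
      where
      lemma₁ : ∀ h Y → h * (1ℤ + Y) * (h * (1ℤ + Y)) - h * (1ℤ - Y) * (h * (1ℤ - Y))
                       ≡ (h * (1ℤ + Y) + h * (1ℤ - Y)) * ((+ 2 * h) * Y)
      lemma₁ = solve-∀
      lemma₂ : ∀ Y → 1ℤ * (1ℤ * Y) ≡ Y
      lemma₂ = solve-∀

module PrimeModulus {q : ℕ} (p-prime : Prime (suc q)) where

  p : ℕ
  p = suc q

  open IntegersModulo p
  open import Relation.Binary.Reasoning.Setoid setoid

  1<p : 1 < p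
  1<p = ℕ.nonTrivial⇒n>1 p {{prime⇒nonTrivial p-prime}}

  1≉0 : ¬ 1ℤ ≈ 0ℤ
  1≉0 1≈0 with () ← ≈⇒≡ 1<p (s≤s z≤n) 1≈0

  *≈-1⇒≉0 : ∀ {a b} → a * b ≈ - 1ℤ → ¬ a ≈ 0ℤ
  *≈-1⇒≉0 {a} {b} ab≈-1 a≈0 = 1≉0 (begin
    1ℤ           ≡⟨⟩
    - - 1ℤ       ≈⟨ -‿cong ab≈-1 ⟨
    - (a * b)    ≈⟨ -‿cong (*-congʳ b a≈0) ⟩
    - (0ℤ * b)   ≡⟨ cong -_ (ℤ.*-zeroˡ b) ⟩
    0ℤ           ∎)

  *≈0⇒≈0⊎≈0 : ∀ {a b} → a * b ≈ 0ℤ → a ≈ 0ℤ ⊎ b ≈ 0ℤ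
  *≈0⇒≈0⊎≈0 {a} {b} ab≈0
    with euclidsLemma ∣ a ∣ ∣ b ∣ p-prime (subst (p ∣_) (ℤ.abs-* a b) (ℤ.∣⇒∣ᵤ (≈0⇒∣ ab≈0)))
  ... | inj₁ p∣a = inj₁ (∣⇒≈0 (ℤ.∣ᵤ⇒∣ p∣a))
  ... | inj₂ p∣b = inj₂ (∣⇒≈0 (ℤ.∣ᵤ⇒∣ p∣b))

  *-cancelˡ-nonZero : ∀ a {b c} → ¬ a ≈ 0ℤ → a * b ≈ a * c → b ≈ c
  *-cancelˡ-nonZero a {b} {c} a≉0 (n∣difference n∣ab-ac) =
    [ (λ a≈0 → ⊥-elim (a≉0 a≈0)) , (λ b-c≈0 → n∣difference (≈0⇒∣ b-c≈0)) ]′ (*≈0⇒≈0⊎≈0 a[b-c]≈0)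
    where
    lemma : ∀ a b c → a * b - a * c ≡ a * (b - c)
    lemma = solve-∀
    a[b-c]≈0 : a * (b - c) ≈ 0ℤ
    a[b-c]≈0 = ∣⇒≈0 (subst (+ p ℤ.∣_) (lemma a b c) n∣ab-ac)

  1^n≈1 : ∀ n → 1ℤ ^ n ≈ 1ℤ
  1^n≈1 zero    = ≈-reflexive refl
  1^n≈1 (suc n) = ≈-trans (≈-reflexive (ℤ.*-identityˡ (1ℤ ^ n))) (1^n≈1 n)

  open Frobenius commutativeSemiring p-prime using ([x+y]^p≈x^p+y^p)

  x^p≈x : ∀ x → x ^ p ≈ x
  x^p≈x x = begin
    x ^ p                ≈⟨ ^-congˡ p (≈-%ℕ x) ⟩
    (+ (x %ℕ p)) ^ p     ≈⟨ k^p≈k (x %ℕ p) ⟩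
    + (x %ℕ p)           ≈⟨ ≈-sym (≈-%ℕ x) ⟩
    x                    ∎
    where
    k^p≈k : ∀ k → (+ k) ^ p ≈ + k
    k^p≈k zero    = ≈-reflexive (ℤ.*-zeroˡ ((+ 0) ^ q))
    k^p≈k (suc k) = begin
      (1ℤ + + k) ^ p        ≈⟨ [x+y]^p≈x^p+y^p n×x≈0 1ℤ (+ k) ⟩
      1ℤ ^ p + (+ k) ^ p    ≈⟨ +-cong (1^n≈1 p) (k^p≈k k) ⟩
      1ℤ + + k              ∎

  x^[p∸1]≈1 : ∀ {x} → ¬ x ≈ 0ℤ → x ^ (p ℕ.∸ 1) ≈ 1ℤ
  x^[p∸1]≈1 {x} x≉0 = *-cancelˡ-nonZero x x≉0 (≈-trans (x^p≈x x) (≈-reflexive (≡.sym (ℤ.*-identityʳ x))))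

  [x*x]^m≈1 : ∀ m {x} → p ≡ suc (m ℕ.+ m) → ¬ x ≈ 0ℤ → (x * x) ^ m ≈ 1ℤ
  [x*x]^m≈1 m {x} refl x≉0 = begin
    (x * x) ^ m      ≈⟨ ^-distrib-* x x m ⟩
    x ^ m * x ^ m    ≈⟨ ^-homo-* x m m ⟨
    x ^ (m ℕ.+ m)    ≈⟨ x^[p∸1]≈1 x≉0 ⟩
    1ℤ               ∎

markoffStep : ℕ → ℕ × ℕ → ℕ × ℕ
markoffStep p (a , b) = b , (3 ℕ.* b ℕ.+ (p ℕ.∸ a)) mod p

markoffPair : ℕ → ℕ → ℕ × ℕ
markoffPair p zero    = 1 , 1
markoffPair p (suc k) = markoffStep p (markoffPair p k)

-- rot_i fixes the i-th coordinate, so on the orbit of (1, 1, 1) it only moves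
-- the other two, by markoffStep.
insertOne : Fin 3 → ℕ × ℕ → Point
insertOne zero             (a , b) = 1 , a , b
insertOne (suc zero)       (a , b) = a , 1 , b
insertOne (suc (suc zero)) (a , b) = a , b , 1

insertOne-1,1 : ∀ i → insertOne i (1 , 1) ≡ (1 , 1 , 1)
insertOne-1,1 zero             = refl
insertOne-1,1 (suc zero)       = refl
insertOne-1,1 (suc (suc zero)) = refl

rot-insertOne : ∀ p i ab → rot p i (insertOne i ab) ≡ insertOne i (markoffStep p ab)
rot-insertOne p zero             (a , b) = refl
rot-insertOne p (suc zero)       (a , b) = refl
rot-insertOne p (suc (suc zero)) (a , b) =
  cong (λ c → b , (c ℕ.+ (p ℕ.∸ a)) mod p , 1) (ℕ.*-identityʳ (3 ℕ.* b))

rotIter-insertOne : ∀ p i k → rotIter p i k (1 , 1 , 1) ≡ insertOne i (markoffPair p k)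
rotIter-insertOne p i zero    = ≡.sym (insertOne-1,1 i)
rotIter-insertOne p i (suc k) =
  ≡.trans (cong (rot p i) (rotIter-insertOne p i k)) (rot-insertOne p i (markoffPair p k))

mod-< : ∀ a {p} → 0 < p → a mod p < p
mod-< a {suc p} _ = m%n<n a (suc p)

markoffPair-< : ∀ {p} → 1 < p → ∀ k → proj₁ (markoffPair p k) < p × proj₂ (markoffPair p k) < p
markoffPair-< 1<p zero = 1<p , 1<p
markoffPair-< 1<p (suc k) =
  proj₂ (markoffPair-< 1<p k) , mod-< _ (ℕ.<-trans (s≤s z≤n) 1<p)

module HyperbolicOrbit (m : ℕ) (p-prime : Prime (suc (m ℕ.+ m)))
                (hyperbolic : OneHyperbolic (suc (m ℕ.+ m))) where

  open PrimeModulus p-prime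
  open IntegersModulo p
  open import Relation.Binary.Reasoning.Setoid setoid

  Y : ℤ
  Y = + proj₁ (proj₂ hyperbolic)

  Y²≈5 : Y * Y ≈ + 5
  Y²≈5 = begin
    Y * Y                    ≡⟨ ℤ.pos-* y y ⟨
    + (y ℕ.* y)              ≈⟨ ≈-%ℕ (+ (y ℕ.* y)) ⟩
    + ((y ℕ.* y) mod p)      ≡⟨ cong +_ (proj₂ (proj₂ hyperbolic)) ⟩
    + (5 mod p)              ≈⟨ ≈-%ℕ (+ 5) ⟨
    + 5                      ∎
    where
    y : ℕ
    y = proj₁ (proj₂ hyperbolic)

  Y≉0 : ¬ Y ≈ 0ℤ
  Y≉0 Y≈0 = proj₁ hyperbolic (≈⇒≡ (mod-< 5 (s≤s z≤n)) (s≤s z≤n) 5≈0)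
    where
    5≈0 : + (5 mod p) ≈ + 0
    5≈0 = begin
      + (5 mod p)  ≈⟨ ≈-%ℕ (+ 5) ⟨
      + 5          ≈⟨ Y²≈5 ⟨
      Y * Y        ≈⟨ *-congʳ Y Y≈0 ⟩
      0ℤ * Y       ≡⟨ ℤ.*-zeroˡ Y ⟩
      + 0          ∎

  2h≈1 : + 2 * + suc m ≈ 1ℤ
  2h≈1 = ≈-by p≡2h-1 ℤ.∣-refl
    where
    lemma : ∀ m → 1ℤ + (m + m) ≡ + 2 * (1ℤ + m) - 1ℤ
    lemma = solve-∀
    p≡2h-1 : + p ≡ + 2 * + suc m - 1ℤ
    p≡2h-1 = ≡.trans (cong (_+_ 1ℤ) (ℤ.pos-+ m m)) (lemma (+ m))

  open GoldenRatio Y (+ suc m) Y²≈5 2h≈1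

  φ≉0 : ¬ φ ≈ 0ℤ
  φ≉0 = *≈-1⇒≉0 φψ≈-1

  ψ≉0 : ¬ ψ ≈ 0ℤ
  ψ≉0 = *≈-1⇒≉0 (≈-trans (≈-reflexive (ℤ.*-comm ψ φ)) φψ≈-1)

  a b : ℕ → ℤ
  a k = + proj₁ (markoffPair p k)
  b k = + proj₂ (markoffPair p k)

  b-suc : ∀ k → b (suc k) ≈ + 3 * b k - a k
  b-suc k = begin
    + ((3 ℕ.* b′ ℕ.+ (p ℕ.∸ a′)) mod p)  ≈⟨ ≈-%ℕ (+ (3 ℕ.* b′ ℕ.+ (p ℕ.∸ a′))) ⟨
    + (3 ℕ.* b′ ℕ.+ (p ℕ.∸ a′))          ≡⟨ ≡.trans (ℤ.pos-+ (3 ℕ.* b′) (p ℕ.∸ a′)) (cong (_+ + (p ℕ.∸ a′)) (ℤ.pos-* 3 b′)) ⟩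
    + 3 * + b′ + + (p ℕ.∸ a′)            ≈⟨ +-congˡ (+ 3 * + b′) (n∸a≈-a (ℕ.<⇒≤ (proj₁ (markoffPair-< 1<p k)))) ⟩
    + 3 * + b′ - + a′                    ∎
    where
    a′ b′ : ℕ
    a′ = proj₁ (markoffPair p k)
    b′ = proj₂ (markoffPair p k)

  open Orbit (+ 3) a b (λ _ → ≈-reflexive refl) b-suc

  markoffPair-half : markoffPair p m ≡ (1 , 1)
  markoffPair-half = cong₂ _,_ (≈⇒≡ (proj₁ bounds) 1<p (proj₁ returns))
                               (≈⇒≡ (proj₂ bounds) 1<p (proj₂ returns))
    where
    cancel : ∀ {x y} → (α - β) * x ≈ (α - β) * y → x ≈ y
    cancel = *-cancelˡ-nonZero (α - β) (λ α-β≈0 → Y≉0 (≈-trans (≈-sym α-β≈Y) α-β≈0))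
    returns : a m ≈ a 0 × b m ≈ b 0
    returns = periodic {α} {β} {m} α+β≈3 αβ≈1 ([x*x]^m≈1 m refl φ≉0) ([x*x]^m≈1 m refl ψ≉0) cancel
    bounds : proj₁ (markoffPair p m) < p × proj₂ (markoffPair p m) < p
    bounds = markoffPair-< 1<p m

  rotIter-half : ∀ i → rotIter p i m (1 , 1 , 1) ≡ (1 , 1 , 1)
  rotIter-half i = ≡.trans (rotIter-insertOne p i m)
                     (≡.trans (cong (insertOne i) markoffPair-half) (insertOne-1,1 i))

half<maximal-order : ∀ {m n} → 0 < m → let p = suc (m ℕ.+ m) in
                     n ≡ p ℕ.∸ 1 ⊎ n ≡ p ℕ.+ 1 ⊎ n ≡ 2 ℕ.* p → m < n
half<maximal-order {m} 0<m (inj₁ refl)        = ℕ.m<m+n m 0<m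
half<maximal-order {m} _   (inj₂ (inj₁ refl)) = ℕ.<-≤-trans (s≤s (ℕ.m≤m+n m m)) (ℕ.m≤m+n _ 1)
half<maximal-order {m} _   (inj₂ (inj₂ refl)) = ℕ.<-≤-trans (s≤s (ℕ.m≤m+n m m)) (ℕ.m≤m+n _ _)

proposition5p1 : (p : ℕ) → Prime p → p ≢ 2 → OneHyperbolic p →
    ¬ InCage p (1 , 1 , 1)
proposition5p1 p p-prime p≢2 hyperbolic (_ , i , n , (_ , _ , minimal) , maximal)
  with m , 0<m , refl ← prime≢2⇒odd p-prime p≢2 =
  minimal m 0<m (half<maximal-order 0<m maximal) (HyperbolicOrbit.rotIter-half m p-prime hyperbolic i)
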